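{- Let $U\subset W\subset V$ be binary projective spaces ($U$ a subspace of $W$, $W$ a subspace of $V$), and let $d=\dim(V)-\dim(W)+\dim(U)$. Then there exist subspaces $U_1,\dots,U_m$ of $V$ such that (1) $m\ge 2^{\dim(V)-2d}$; (2) $\dim(U_i)=d$ and $U_i\cap W=U$ for every $i\in[m]$; (3) $U_i\cap U_j=U$ for all distinct $i,j\in[m]$.
   Context: A binary projective space is a set $V=V'\setminus\{0\}$ where $V'$ is a finite-dimensional $\mathbb{F}_2$-vector space; its dimension $\dim(V)$ is $\dim_{\mathbb{F}_2}(V')$. A subspace of $V$ is a set $U'\setminus\{0\}$ with $U'$ a linear subspace of $V'$, and its dimension is $\dim_{\mathbb{F}_2}(U')$. Intersections are set intersections. -}

module Defs where

open import Data.Bool using (Bool; true; false; _xor_)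
open import Data.Nat using (ℕ; zero; suc; _+_; _∸_; _^_; _≥_)
open import Data.Fin using (Fin)
open import Data.Vec using (Vec; []; _∷_; replicate; zipWith)
open import Data.Product using (Σ; ∃; _×_; _,_)
open import Relation.Binary.PropositionalEquality using (_≡_; _≢_)

-- The ambient F₂-vector space V' = F₂ⁿ, with F₂ = Bool (xor = addition).
Vector : ℕ → Set
Vector n = Vec Bool n

0v : ∀ {n} → Vector n
0v = replicate _ false

_⊕_ : ∀ {n} → Vector n → Vector n → Vector n
_⊕_ = zipWith _xor_

record Subspace (n : ℕ) : Set₁ where
  field
    _∋_    : Vector n → Set
    has-0  : _∋_ 0v
    closed : ∀ x y → _∋_ x → _∋_ y → _∋_ (x ⊕ y)
open Subspace public

comb : ∀ {n k} → Vec (Vector n) k → Vec Bool k → Vector n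
comb []       []          = 0v
comb (b ∷ bs) (true  ∷ c) = b ⊕ comb bs c
comb (b ∷ bs) (false ∷ c) = comb bs c

record Dim {n : ℕ} (U : Subspace n) (k : ℕ) : Set where
  field
    basis     : Vec (Vector n) k
    spans     : ∀ x → U ∋ x → Σ (Vec Bool k) λ c → comb basis c ≡ x
    in-U      : ∀ c → U ∋ comb basis c
    indep     : ∀ c → comb basis c ≡ 0v → c ≡ replicate _ false

_⊆_ : ∀ {n} → Subspace n → Subspace n → Set
U ⊆ W = ∀ x → U ∋ x → W ∋ x

∩≡ : ∀ {n} → Subspace n → Subspace n → Subspace n → Set
∩≡ A B C = ∀ x → ((A ∋ x × B ∋ x) → C ∋ x) × (C ∋ x → (A ∋ x × B ∋ x))

-- Extend a basis B of U to bases E ++ B of W and C ++ E ++ B of F₂ⁿ, so that k = |C| = n − dim W,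
-- l = |E| and d = k + u.  For each linear map A : F₂ᵏ → F₂ˡ, the span of U and of the graph
-- {Σ βᵢcᵢ + Σ (Aβ)ᵢeᵢ} has dimension d and meets W exactly in U; two such subspaces meet exactly
-- in U as soon as A − A′ is injective.  Reading vectors as polynomials over F₂, multiplication by
-- each of the 2^(l−k) polynomials τ of degree < l − k is such a family, since F₂[x] has no zero
-- divisors; and l − k = n − 2d + u ≥ n − 2d.

module Submission where

open import Defs
open import Data.Bool using (Bool; true; false; _xor_; _≟_)
open import Data.Bool.Properties using (xor-assoc; xor-comm; xor-identityˡ; xor-identityʳ; xor-same)
open import Data.Empty using (⊥-elim)
open import Data.Fin using (Fin; zero; suc; combine; funToFin; finToFun)
open import Data.Fin.Properties using (injective⇒≤; finToFun-funToFin; funToFin-finToFin)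
open import Data.Nat using (ℕ; zero; suc; _+_; _*_; _∸_; _^_; _≤_; _≥_; _≤?_; z≤n; s≤s)
open import Data.Nat.Properties
  using (module ≤-Reasoning; ≤-refl; ≤-trans; ≤-reflexive; ≤-antisym; <-irrefl; +-suc; +-comm; +-assoc;
         +-monoʳ-≤; m≤m+n; ∸-monoʳ-≤; ^-monoʳ-≤; ^-monoʳ-<; <⇒≱; ≮⇒≥; ≰⇒>; <⇒≤;
         m≤n⇒m∸n≡0; m+[n∸m]≡n; m+n∸n≡m; [m+n]∸[m+o]≡n∸o)
open import Data.Product using (Σ; ∃-syntax; _×_; _,_; proj₁; proj₂)
open import Data.Sum using (_⊎_; inj₁; inj₂; map₂)
open import Data.Vec using (Vec; []; _∷_; _++_; map; lookup; tabulate; take; drop)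
open import Data.Vec.Properties
  using (zipWith-assoc; zipWith-identityˡ; zipWith-identityʳ; zipWith-++; take-zipWith; drop-zipWith;
         take++drop≡id; ++-injectiveˡ; ++-injectiveʳ; ∷-injectiveʳ; lookup∘tabulate; tabulate∘lookup;
         tabulate-cong; ≡-dec)
open import Function using (id; _∘_)
open import Function.Definitions using (Injective)
open import Relation.Binary.PropositionalEquality
open import Relation.Nullary using (¬_; Dec; yes; no; contradiction)

-- Vector arithmetic over F₂

⊕-assoc : ∀ {n} (x y z : Vector n) → (x ⊕ y) ⊕ z ≡ x ⊕ (y ⊕ z)
⊕-assoc = zipWith-assoc xor-assoc

⊕-comm : ∀ {n} (x y : Vector n) → x ⊕ y ≡ y ⊕ x
⊕-comm []      []      = refl
⊕-comm (a ∷ x) (b ∷ y) = cong₂ _∷_ (xor-comm a b) (⊕-comm x y)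

⊕-identityˡ : ∀ {n} (x : Vector n) → 0v ⊕ x ≡ x
⊕-identityˡ = zipWith-identityˡ xor-identityˡ

⊕-identityʳ : ∀ {n} (x : Vector n) → x ⊕ 0v ≡ x
⊕-identityʳ = zipWith-identityʳ xor-identityʳ

⊕-self : ∀ {n} (x : Vector n) → x ⊕ x ≡ 0v
⊕-self []      = refl
⊕-self (a ∷ x) = cong₂ _∷_ (xor-same a) (⊕-self x)

⊕-cancelˡ : ∀ {n} (x y : Vector n) → x ⊕ (x ⊕ y) ≡ y
⊕-cancelˡ x y = begin
  x ⊕ (x ⊕ y) ≡⟨ ⊕-assoc x x y ⟨
  (x ⊕ x) ⊕ y ≡⟨ cong (_⊕ y) (⊕-self x) ⟩
  0v ⊕ y      ≡⟨ ⊕-identityˡ y ⟩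
  y           ∎
  where open ≡-Reasoning

x⊕y≡0⇒x≡y : ∀ {n} (x y : Vector n) → x ⊕ y ≡ 0v → x ≡ y
x⊕y≡0⇒x≡y x y eq = begin
  x            ≡⟨ ⊕-identityʳ x ⟨
  x ⊕ 0v       ≡⟨ cong (x ⊕_) eq ⟨
  x ⊕ (x ⊕ y)  ≡⟨ ⊕-cancelˡ x y ⟩
  y            ∎
  where open ≡-Reasoning

⊕-interchange : ∀ {n} (a b c d : Vector n) → (a ⊕ b) ⊕ (c ⊕ d) ≡ (a ⊕ c) ⊕ (b ⊕ d)
⊕-interchange a b c d = begin
  (a ⊕ b) ⊕ (c ⊕ d) ≡⟨ ⊕-assoc a b (c ⊕ d) ⟩
  a ⊕ (b ⊕ (c ⊕ d)) ≡⟨ cong (a ⊕_) (⊕-assoc b c d) ⟨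
  a ⊕ ((b ⊕ c) ⊕ d) ≡⟨ cong (λ z → a ⊕ (z ⊕ d)) (⊕-comm b c) ⟩
  a ⊕ ((c ⊕ b) ⊕ d) ≡⟨ cong (a ⊕_) (⊕-assoc c b d) ⟩
  a ⊕ (c ⊕ (b ⊕ d)) ≡⟨ ⊕-assoc a c (b ⊕ d) ⟨
  (a ⊕ c) ⊕ (b ⊕ d) ∎
  where open ≡-Reasoning

take-++ : ∀ {A : Set} {m p} (xs : Vec A m) (ys : Vec A p) → take m (xs ++ ys) ≡ xs
take-++ {m = m} xs ys = ++-injectiveˡ (take m (xs ++ ys)) xs (take++drop≡id m (xs ++ ys))

drop-++ : ∀ {A : Set} {m p} (xs : Vec A m) (ys : Vec A p) → drop m (xs ++ ys) ≡ ys
drop-++ {m = m} xs ys = ++-injectiveʳ (take m (xs ++ ys)) xs (take++drop≡id m (xs ++ ys))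

scale : ∀ {n} → Bool → Vector n → Vector n
scale true  x = x
scale false x = 0v

scale-⊕ : ∀ {n} b (x y : Vector n) → scale b (x ⊕ y) ≡ scale b x ⊕ scale b y
scale-⊕ true  x y = refl
scale-⊕ false x y = sym (⊕-self 0v)

scale-xor : ∀ {n} a b (x : Vector n) → scale (a xor b) x ≡ scale a x ⊕ scale b x
scale-xor true  true  x = sym (⊕-self x)
scale-xor true  false x = sym (⊕-identityʳ x)
scale-xor false b     x = sym (⊕-identityˡ (scale b x))

scale-false∷ : ∀ {n} b (x : Vector n) → scale b (false ∷ x) ≡ false ∷ scale b x
scale-false∷ true  x = refl
scale-false∷ false x = refl

Linear : ∀ {p n} → (Vector p → Vector n) → Set
Linear f = ∀ x y → f (x ⊕ y) ≡ f x ⊕ f y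

Linear⇒0↦0 : ∀ {p n} {f : Vector p → Vector n} → Linear f → f 0v ≡ 0v
Linear⇒0↦0 {f = f} f-linear = begin
  f 0v           ≡⟨ cong f (⊕-self 0v) ⟨
  f (0v ⊕ 0v)    ≡⟨ f-linear 0v 0v ⟩
  f 0v ⊕ f 0v    ≡⟨ ⊕-self (f 0v) ⟩
  0v             ∎
  where open ≡-Reasoning

image : ∀ {p n} (f : Vector p → Vector n) → Linear f → Subspace n
image f f-linear = record
  { _∋_    = λ x → ∃[ c ] f c ≡ x
  ; has-0  = 0v , Linear⇒0↦0 f-linear
  ; closed = λ { x y (c , refl) (d , refl) → c ⊕ d , f-linear c d }
  }

comb-∷ : ∀ {n k} x (X : Vec (Vector n) k) b c → comb (x ∷ X) (b ∷ c) ≡ scale b x ⊕ comb X c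
comb-∷ x X true  c = refl
comb-∷ x X false c = sym (⊕-identityˡ (comb X c))

comb-0v : ∀ {n k} (X : Vec (Vector n) k) → comb X 0v ≡ 0v
comb-0v []      = refl
comb-0v (x ∷ X) = comb-0v X

comb-⊕ : ∀ {n k} (X : Vec (Vector n) k) → Linear (comb X)
comb-⊕ []      []      []      = sym (⊕-self 0v)
comb-⊕ (x ∷ X) (b ∷ c) (b′ ∷ c′) = begin
    comb (x ∷ X) ((b xor b′) ∷ (c ⊕ c′))
  ≡⟨ comb-∷ x X (b xor b′) (c ⊕ c′) ⟩
    scale (b xor b′) x ⊕ comb X (c ⊕ c′)
  ≡⟨ cong₂ _⊕_ (scale-xor b b′ x) (comb-⊕ X c c′) ⟩
    (scale b x ⊕ scale b′ x) ⊕ (comb X c ⊕ comb X c′)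
  ≡⟨ ⊕-interchange _ _ _ _ ⟩
    (scale b x ⊕ comb X c) ⊕ (scale b′ x ⊕ comb X c′)
  ≡⟨ cong₂ _⊕_ (comb-∷ x X b c) (comb-∷ x X b′ c′) ⟨
    comb (x ∷ X) (b ∷ c) ⊕ comb (x ∷ X) (b′ ∷ c′)
  ∎
  where open ≡-Reasoning

comb-++ : ∀ {n p q} (X : Vec (Vector n) p) (Y : Vec (Vector n) q) c d →
          comb (X ++ Y) (c ++ d) ≡ comb X c ⊕ comb Y d
comb-++ []      Y []      d = sym (⊕-identityˡ (comb Y d))
comb-++ (x ∷ X) Y (b ∷ c) d = begin
  comb (x ∷ X ++ Y) (b ∷ c ++ d)        ≡⟨ comb-∷ x (X ++ Y) b (c ++ d) ⟩
  scale b x ⊕ comb (X ++ Y) (c ++ d)    ≡⟨ cong (scale b x ⊕_) (comb-++ X Y c d) ⟩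
  scale b x ⊕ (comb X c ⊕ comb Y d)     ≡⟨ ⊕-assoc _ _ _ ⟨
  (scale b x ⊕ comb X c) ⊕ comb Y d     ≡⟨ cong (_⊕ comb Y d) (comb-∷ x X b c) ⟨
  comb (x ∷ X) (b ∷ c) ⊕ comb Y d       ∎
  where open ≡-Reasoning

comb-0v++ : ∀ {n p q} (X : Vec (Vector n) p) (Y : Vec (Vector n) q) d →
            comb (X ++ Y) (0v ++ d) ≡ comb Y d
comb-0v++ X Y d = begin
  comb (X ++ Y) (0v ++ d)  ≡⟨ comb-++ X Y 0v d ⟩
  comb X 0v ⊕ comb Y d     ≡⟨ cong (_⊕ comb Y d) (comb-0v X) ⟩
  0v ⊕ comb Y d            ≡⟨ ⊕-identityˡ (comb Y d) ⟩
  comb Y d                 ∎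
  where open ≡-Reasoning

comb-map : ∀ {p n k} {f : Vector p → Vector n} → Linear f →
           ∀ (X : Vec (Vector p) k) c → comb (map f X) c ≡ f (comb X c)
comb-map f-linear []      []          = sym (Linear⇒0↦0 f-linear)
comb-map f-linear (x ∷ X) (true ∷ c)  =
  trans (cong (_ ⊕_) (comb-map f-linear X c)) (sym (f-linear x (comb X c)))
comb-map f-linear (x ∷ X) (false ∷ c) = comb-map f-linear X c

false∷-linear : ∀ {p} → Linear {p} (false ∷_)
false∷-linear x y = refl

standardBasis : ∀ p → Vec (Vector p) p
standardBasis zero    = []
standardBasis (suc p) = (true ∷ 0v) ∷ map (false ∷_) (standardBasis p)

comb-standardBasis : ∀ {p} (c : Vector p) → comb (standardBasis p) c ≡ c
comb-standardBasis []          = refl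
comb-standardBasis (true ∷ c)  = begin
    (true ∷ 0v) ⊕ comb (map (false ∷_) (standardBasis _)) c
  ≡⟨ cong ((true ∷ 0v) ⊕_) (comb-map false∷-linear (standardBasis _) c) ⟩
    true ∷ (0v ⊕ comb (standardBasis _) c)
  ≡⟨ cong (true ∷_) (⊕-identityˡ _) ⟩
    true ∷ comb (standardBasis _) c
  ≡⟨ cong (true ∷_) (comb-standardBasis c) ⟩
    true ∷ c
  ∎
  where open ≡-Reasoning
comb-standardBasis (false ∷ c) =
  trans (comb-map false∷-linear (standardBasis _) c) (cong (false ∷_) (comb-standardBasis c))

-- Spans, independence and dimension

span : ∀ {n k} → Vec (Vector n) k → Subspace n
span X = image (comb X) (comb-⊕ X)

Independent : ∀ {n k} → Vec (Vector n) k → Set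
Independent X = ∀ c → comb X c ≡ 0v → c ≡ 0v

comb-injective : ∀ {n k} (X : Vec (Vector n) k) → Independent X → Injective _≡_ _≡_ (comb X)
comb-injective X X-independent {c} {d} eq = x⊕y≡0⇒x≡y c d (X-independent (c ⊕ d) (begin
  comb X (c ⊕ d)        ≡⟨ comb-⊕ X c d ⟩
  comb X c ⊕ comb X d   ≡⟨ cong (_⊕ comb X d) eq ⟩
  comb X d ⊕ comb X d   ≡⟨ ⊕-self (comb X d) ⟩
  0v                    ∎))
  where open ≡-Reasoning

image-dim : ∀ {p n} {f : Vector p → Vector n} (f-linear : Linear f) → Injective _≡_ _≡_ f →
            Dim (image f f-linear) p
image-dim {p} {f = f} f-linear f-injective = record
  { basis  = map f (standardBasis p)
  ; spans  = λ { x (c , refl) → c , comb-image-basis c }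
  ; in-U   = λ c → c , sym (comb-image-basis c)
  ; indep  = λ c eq → f-injective (trans (sym (comb-image-basis c)) (trans eq (sym (Linear⇒0↦0 f-linear))))
  }
  where
  comb-image-basis : ∀ c → comb (map f (standardBasis p)) c ≡ f c
  comb-image-basis c = trans (comb-map f-linear (standardBasis p) c) (cong f (comb-standardBasis c))

bitToFin : Bool → Fin 2
bitToFin false = zero
bitToFin true  = suc zero

finToBit : Fin 2 → Bool
finToBit zero       = false
finToBit (suc zero) = true

finToBit-bitToFin : ∀ b → finToBit (bitToFin b) ≡ b
finToBit-bitToFin false = refl
finToBit-bitToFin true  = refl

bitToFin-finToBit : ∀ i → bitToFin (finToBit i) ≡ i
bitToFin-finToBit zero       = refl
bitToFin-finToBit (suc zero) = refl

encode : ∀ {a} → Vector a → Fin (2 ^ a)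
encode v = funToFin (bitToFin ∘ lookup v)

decode : ∀ a → Fin (2 ^ a) → Vector a
decode a i = tabulate (finToBit ∘ finToFun i)

funToFin-cong : ∀ {m n} {f g : Fin m → Fin n} → (∀ i → f i ≡ g i) → funToFin f ≡ funToFin g
funToFin-cong {zero}  f≗g = refl
funToFin-cong {suc m} f≗g = cong₂ combine (f≗g zero) (funToFin-cong (f≗g ∘ suc))

encode-decode : ∀ a (i : Fin (2 ^ a)) → encode (decode a i) ≡ i
encode-decode a i = trans (funToFin-cong bits) (funToFin-finToFin {a} i)
  where
  bits : ∀ j → bitToFin (lookup (decode a i) j) ≡ finToFun i j
  bits j = trans (cong bitToFin (lookup∘tabulate _ j)) (bitToFin-finToBit (finToFun i j))

decode-injective : ∀ a → Injective _≡_ _≡_ (decode a)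
decode-injective a {i} {j} eq = trans (sym (encode-decode a i)) (trans (cong encode eq) (encode-decode a j))

decode-encode : ∀ {a} (v : Vector a) → decode a (encode v) ≡ v
decode-encode {a} v = begin
  tabulate (finToBit ∘ finToFun (encode v))  ≡⟨ tabulate-cong (λ j → cong finToBit (finToFun-funToFin _ j)) ⟩
  tabulate (finToBit ∘ bitToFin ∘ lookup v)  ≡⟨ tabulate-cong (λ j → finToBit-bitToFin (lookup v j)) ⟩
  tabulate (lookup v)                        ≡⟨ tabulate∘lookup v ⟩
  v                                          ∎
  where open ≡-Reasoning

encode-injective : ∀ {a} → Injective _≡_ _≡_ (encode {a})
encode-injective {a} {v} {w} eq = trans (sym (decode-encode v)) (trans (cong (decode a) eq) (decode-encode w))

injective⇒dim≤ : ∀ {a b} {f : Vector a → Vector b} → Injective _≡_ _≡_ f → a ≤ b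
injective⇒dim≤ {a} {b} {f} f-injective = ≮⇒≥ λ b<a → <⇒≱ (^-monoʳ-< 2 (s≤s (s≤s z≤n)) b<a) 2^a≤2^b
  where
  2^a≤2^b : 2 ^ a ≤ 2 ^ b
  2^a≤2^b = injective⇒≤ {f = encode ∘ f ∘ decode a} (decode-injective a ∘ f-injective ∘ encode-injective)

basis⊆ : ∀ {n s} {S : Subspace n} (D : Dim S s) → span (Dim.basis D) ⊆ S
basis⊆ D x (c , refl) = Dim.in-U D c

independent⇒≤ : ∀ {n a b} (X : Vec (Vector n) a) (Y : Vec (Vector n) b) →
                Independent X → span X ⊆ span Y → a ≤ b
independent⇒≤ {a = a} {b} X Y X-independent X⊆Y = injective⇒dim≤ coordinates-injective
  where
  coordinates : Vector a → Vector b
  coordinates c = proj₁ (X⊆Y (comb X c) (c , refl))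

  coordinates-correct : ∀ c → comb Y (coordinates c) ≡ comb X c
  coordinates-correct c = proj₂ (X⊆Y (comb X c) (c , refl))

  coordinates-injective : Injective _≡_ _≡_ coordinates
  coordinates-injective {c} {d} eq = comb-injective X X-independent (begin
    comb X c                  ≡⟨ coordinates-correct c ⟨
    comb Y (coordinates c)    ≡⟨ cong (comb Y) eq ⟩
    comb Y (coordinates d)    ≡⟨ coordinates-correct d ⟩
    comb X d                  ∎)
    where open ≡-Reasoning

basis-length : ∀ {n s a} {S : Subspace n} (X : Vec (Vector n) a) → Dim S s →
               Independent X → span X ⊆ S → S ⊆ span X → a ≡ s
basis-length X D X-independent X⊆S S⊆X = ≤-antisym
  (independent⇒≤ X (Dim.basis D) X-independent (λ x → Dim.spans D x ∘ X⊆S x))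
  (independent⇒≤ (Dim.basis D) X (Dim.indep D) (λ x → S⊆X x ∘ basis⊆ D x))

∈span? : ∀ {n k} (X : Vec (Vector n) k) v → Dec (span X ∋ v)
∈span? [] v with ≡-dec _≟_ 0v v
... | yes eq  = yes ([] , eq)
... | no  neq = no λ { ([] , eq) → neq eq }
∈span? (x ∷ X) v with ∈span? X (x ⊕ v) | ∈span? X v
... | yes (c , eq) | _            = yes (true ∷ c , trans (cong (x ⊕_) eq) (⊕-cancelˡ x v))
... | no  _        | yes (c , eq) = yes (false ∷ c , eq)
... | no  x⊕v∉     | no  v∉       = no λ
  { (true  ∷ c , eq) → x⊕v∉ (c , trans (sym (⊕-cancelˡ x _)) (cong (x ⊕_) eq))
  ; (false ∷ c , eq) → v∉ (c , eq)
  }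

independent-∷ : ∀ {n k} {v} (X : Vec (Vector n) k) →
                Independent X → ¬ (span X ∋ v) → Independent (v ∷ X)
independent-∷ {v = v} X X-independent v∉ (true  ∷ c) eq = ⊥-elim (v∉ (c , sym (x⊕y≡0⇒x≡y v _ eq)))
independent-∷ X X-independent v∉ (false ∷ c) eq = cong (false ∷_) (X-independent c eq)

span-∷⊆ : ∀ {n k} {v} (X : Vec (Vector n) k) (S : Subspace n) →
          S ∋ v → span X ⊆ S → span (v ∷ X) ⊆ S
span-∷⊆ X S v∈S X⊆S _ (true  ∷ c , refl) = closed S _ _ v∈S (X⊆S _ (c , refl))
span-∷⊆ X S v∈S X⊆S _ (false ∷ c , refl) = X⊆S _ (c , refl)

span⊆-or-escape : ∀ {n a b} (X : Vec (Vector n) a) (Y : Vec (Vector n) b) →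
                  span X ⊆ span Y ⊎ ∃[ v ] (span X ∋ v × ¬ (span Y ∋ v))
span⊆-or-escape [] Y = inj₁ λ { _ ([] , refl) → 0v , comb-0v Y }
span⊆-or-escape (x ∷ X) Y with ∈span? Y x
... | no x∉ = inj₂ (x , (true ∷ 0v , trans (cong (x ⊕_) (comb-0v X)) (⊕-identityʳ x)) , x∉)
... | yes x∈ with span⊆-or-escape X Y
...   | inj₁ X⊆Y                  = inj₁ (span-∷⊆ X (span Y) x∈ X⊆Y)
...   | inj₂ (v , (c , eq) , v∉) = inj₂ (v , (false ∷ c , eq) , v∉)

record BasisExtension {n a} (S : Subspace n) (X : Vec (Vector n) a) : Set where
  field
    {size}      : ℕ
    vectors     : Vec (Vector n) size
    independent : Independent (vectors ++ X)
    span⊆       : span (vectors ++ X) ⊆ S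
    ⊆span       : S ⊆ span (vectors ++ X)

  size+length≡dim : ∀ {s} → Dim S s → size + a ≡ s
  size+length≡dim D = basis-length (vectors ++ X) D independent span⊆ ⊆span

extend-to-basis : ∀ {n a s} {S : Subspace n} → Dim S s → (X : Vec (Vector n) a) →
                  Independent X → span X ⊆ S → BasisExtension S X
extend-to-basis {n} {a} {s} {S} D X = grow s [] ≤-refl
  where
  grow : ∀ fuel {e} (E : Vec (Vector n) e) → s ≤ e + fuel →
         Independent (E ++ X) → span (E ++ X) ⊆ S → BasisExtension S X
  grow fuel {e} E s≤e+fuel E++X-independent E++X⊆S with span⊆-or-escape (Dim.basis D) (E ++ X)
  ... | inj₁ basis⊆E++X = record
    { vectors = E ; independent = E++X-independent ; span⊆ = E++X⊆S
    ; ⊆span = λ x → basis⊆E++X x ∘ Dim.spans D x }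
  ... | inj₂ (v , v∈basis , v∉) = continue fuel s≤e+fuel
    where
    v∷E++X-independent : Independent (v ∷ E ++ X)
    v∷E++X-independent = independent-∷ (E ++ X) E++X-independent v∉

    v∷E++X⊆S : span (v ∷ E ++ X) ⊆ S
    v∷E++X⊆S = span-∷⊆ (E ++ X) S (basis⊆ D v v∈basis) E++X⊆S

    too-long : suc (e + a) ≤ s
    too-long = independent⇒≤ (v ∷ E ++ X) (Dim.basis D) v∷E++X-independent
                 (λ x → Dim.spans D x ∘ v∷E++X⊆S x)

    continue : ∀ fuel → s ≤ e + fuel → BasisExtension S X
    continue (suc fuel) s≤e+1+fuel =
      grow fuel (v ∷ E) (subst (s ≤_) (+-suc e fuel) s≤e+1+fuel) v∷E++X-independent v∷E++X⊆S
    continue zero s≤e+0 = contradiction (≤-trans too-long (≤-trans s≤e+0 (+-monoʳ-≤ e z≤n))) (<-irrefl refl)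

-- Truncated polynomial multiplication over F₂

pad : ∀ {k} q → Vector k → Vector q
pad zero    _        = []
pad (suc q) []       = false ∷ pad q []
pad (suc q) (x ∷ xs) = x ∷ pad q xs

pad-[] : ∀ q → pad q [] ≡ 0v
pad-[] zero    = refl
pad-[] (suc q) = cong (false ∷_) (pad-[] q)

pad-⊕ : ∀ {k} q (x y : Vector k) → pad q (x ⊕ y) ≡ pad q x ⊕ pad q y
pad-⊕ zero    x       y       = refl
pad-⊕ (suc q) []      []      = cong (false ∷_) (begin
  pad q []                  ≡⟨ pad-[] q ⟩
  0v                        ≡⟨ ⊕-self 0v ⟨
  0v ⊕ 0v                   ≡⟨ cong₂ _⊕_ (pad-[] q) (pad-[] q) ⟨
  pad q [] ⊕ pad q []       ∎)
  where open ≡-Reasoning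
pad-⊕ (suc q) (a ∷ x) (b ∷ y) = cong ((a xor b) ∷_) (pad-⊕ q x y)

-- Polynomials over F₂ are coefficient vectors, constant term first; mul q β τ is the vector of
-- the first q coefficients of β τ (zero-padded).
mul : ∀ {k j} q → Vector k → Vector j → Vector q
mul zero    β τ       = []
mul (suc q) β []      = 0v
mul (suc q) β (t ∷ τ) = scale t (pad (suc q) β) ⊕ (false ∷ mul q β τ)

mul-[] : ∀ {k} q (β : Vector k) → mul q β [] ≡ 0v
mul-[] zero    β = refl
mul-[] (suc q) β = refl

mul-⊕ˡ : ∀ {k j} q (τ : Vector j) → Linear (λ (β : Vector k) → mul q β τ)
mul-⊕ˡ zero    τ       β β′ = refl
mul-⊕ˡ (suc q) []      β β′ = sym (⊕-self 0v)
mul-⊕ˡ (suc q) (t ∷ τ) β β′ = begin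
  scale t (pad (suc q) (β ⊕ β′)) ⊕ (false ∷ mul q (β ⊕ β′) τ)
    ≡⟨ cong₂ (λ p r → p ⊕ (false ∷ r)) (trans (cong (scale t) (pad-⊕ (suc q) β β′)) (scale-⊕ t _ _))
                                       (mul-⊕ˡ q τ β β′) ⟩
  (scale t (pad (suc q) β) ⊕ scale t (pad (suc q) β′)) ⊕ ((false ∷ mul q β τ) ⊕ (false ∷ mul q β′ τ))
    ≡⟨ ⊕-interchange _ _ _ _ ⟩
  mul (suc q) β (t ∷ τ) ⊕ mul (suc q) β′ (t ∷ τ)
    ∎
  where open ≡-Reasoning

mul-⊕ʳ : ∀ {k j} q (β : Vector k) → Linear (λ (τ : Vector j) → mul q β τ)
mul-⊕ʳ zero    β τ        τ′        = refl
mul-⊕ʳ (suc q) β []       []        = sym (⊕-self 0v)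
mul-⊕ʳ (suc q) β (t ∷ τ)  (t′ ∷ τ′) = begin
  scale (t xor t′) (pad (suc q) β) ⊕ (false ∷ mul q β (τ ⊕ τ′))
    ≡⟨ cong₂ (λ p r → p ⊕ (false ∷ r)) (scale-xor t t′ _) (mul-⊕ʳ q β τ τ′) ⟩
  (scale t (pad (suc q) β) ⊕ scale t′ (pad (suc q) β)) ⊕ ((false ∷ mul q β τ) ⊕ (false ∷ mul q β τ′))
    ≡⟨ ⊕-interchange _ _ _ _ ⟩
  mul (suc q) β (t ∷ τ) ⊕ mul (suc q) β (t′ ∷ τ′)
    ∎
  where open ≡-Reasoning

mul-shiftˡ : ∀ {k j} q (β : Vector k) (τ : Vector j) → mul (suc q) (false ∷ β) τ ≡ false ∷ mul q β τ
mul-shiftˡ q       β []          = cong (false ∷_) (sym (mul-[] q β))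
mul-shiftˡ zero    β (true  ∷ τ) = refl
mul-shiftˡ zero    β (false ∷ τ) = refl
mul-shiftˡ (suc q) β (t ∷ τ)     =
  cong₂ (λ p r → p ⊕ (false ∷ r)) (scale-false∷ t (pad (suc q) β)) (mul-shiftˡ q β τ)

mul-no-zero-divisors : ∀ {k j} q (β : Vector k) (τ : Vector j) → k + j ≤ q →
                       mul q β τ ≡ 0v → β ≡ 0v ⊎ τ ≡ 0v
mul-no-zero-divisors q       β            []          _ _ = inj₂ refl
mul-no-zero-divisors q       []           (t ∷ τ)     _ _ = inj₁ refl
mul-no-zero-divisors zero    (b ∷ β)      (t ∷ τ)     () _
mul-no-zero-divisors (suc q) (true ∷ β)   (true ∷ τ)  _ ()
mul-no-zero-divisors {suc k} {suc j} (suc q) (true ∷ β) (false ∷ τ) (s≤s k+1+j≤q) eq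
  with mul-no-zero-divisors q (true ∷ β) τ (subst (_≤ q) (+-suc k j) k+1+j≤q)
         (trans (sym (⊕-identityˡ _)) (∷-injectiveʳ eq))
... | inj₁ ()
... | inj₂ τ≡0 = inj₂ (cong (false ∷_) τ≡0)
mul-no-zero-divisors (suc q) (false ∷ β) (t ∷ τ) (s≤s k+j≤q) eq
  with mul-no-zero-divisors q β (t ∷ τ) k+j≤q (∷-injectiveʳ (trans (sym (mul-shiftˡ q β (t ∷ τ))) eq))
... | inj₁ β≡0 = inj₁ (cong (false ∷_) β≡0)
... | inj₂ τ≡0 = inj₂ τ≡0

vectors-of-length-0 : ∀ {j} → j ≡ 0 → (x y : Vector j) → x ≡ y
vectors-of-length-0 refl [] [] = refl

-- For j = k = l this is the spread set of a translation plane.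
record SpreadSet (j k l : ℕ) : Set where
  field
    apply          : Vector j → Vector k → Vector l
    linear         : ∀ τ → Linear (apply τ)
    agree-only-at-0 : ∀ τ τ′ β → apply τ β ≡ apply τ′ β → β ≡ 0v ⊎ τ ≡ τ′

polynomialSpreadSet : ∀ k l → SpreadSet (l ∸ k) k l
polynomialSpreadSet k l = record
  { apply           = λ τ β → mul l β τ
  ; linear          = mul-⊕ˡ l
  ; agree-only-at-0 = agree-only-at-0
  }
  where
  agree-only-at-0 : ∀ τ τ′ β → mul l β τ ≡ mul l β τ′ → β ≡ 0v ⊎ τ ≡ τ′
  agree-only-at-0 τ τ′ β eq with k ≤? l
  ... | no  k≰l = inj₂ (vectors-of-length-0 (m≤n⇒m∸n≡0 (<⇒≤ (≰⇒> k≰l))) τ τ′)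
  ... | yes k≤l = map₂ (x⊕y≡0⇒x≡y τ τ′)
    (mul-no-zero-divisors l β (τ ⊕ τ′) (≤-reflexive (m+[n∸m]≡n k≤l)) (begin
      mul l β (τ ⊕ τ′)           ≡⟨ mul-⊕ʳ l β τ τ′ ⟩
      mul l β τ ⊕ mul l β τ′     ≡⟨ cong (_⊕ mul l β τ′) eq ⟩
      mul l β τ′ ⊕ mul l β τ′    ≡⟨ ⊕-self (mul l β τ′) ⟩
      0v                         ∎))
    where open ≡-Reasoning

SubspaceFamily : (n : ℕ) (U W : Subspace n) (d bound : ℕ) → Set₁
SubspaceFamily n U W d bound = Σ ℕ λ m → Σ (Fin m → Subspace n) λ Us →
  (m ≥ bound)
  × (∀ i → Dim (Us i) d × ∩≡ (Us i) W U)
  × (∀ i j → i ≢ j → ∩≡ (Us i) (Us j) U)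

module GraphConstruction
  {n k l u j} {U W : Subspace n}
  (C : Vec (Vector n) k) (E : Vec (Vector n) l) (DU : Dim U u)
  (CEB-independent : Independent (C ++ E ++ Dim.basis DU))
  (W⊆EB : W ⊆ span (E ++ Dim.basis DU)) (U⊆W : U ⊆ W)
  (A : SpreadSet j k l)
  where

  open SpreadSet A

  B : Vec (Vector n) u
  B = Dim.basis DU

  P : Vec (Vector n) (k + (l + u))
  P = C ++ E ++ B

  coefficients : Vector j → Vector (k + u) → Vector (k + (l + u))
  coefficients τ v = take k v ++ apply τ (take k v) ++ drop k v

  coefficients-linear : ∀ τ → Linear (coefficients τ)
  coefficients-linear τ x y = begin
      take k (x ⊕ y) ++ apply τ (take k (x ⊕ y)) ++ drop k (x ⊕ y)
    ≡⟨ cong (λ β → β ++ apply τ β ++ drop k (x ⊕ y)) (take-zipWith _xor_ x y) ⟩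
      (xₖ ⊕ yₖ) ++ apply τ (xₖ ⊕ yₖ) ++ drop k (x ⊕ y)
    ≡⟨ cong₂ (λ a d → (xₖ ⊕ yₖ) ++ a ++ d) (linear τ xₖ yₖ) (drop-zipWith _xor_ x y) ⟩
      (xₖ ⊕ yₖ) ++ (apply τ xₖ ⊕ apply τ yₖ) ++ (drop k x ⊕ drop k y)
    ≡⟨ cong ((xₖ ⊕ yₖ) ++_) (zipWith-++ _xor_ (apply τ xₖ) (drop k x) (apply τ yₖ) (drop k y)) ⟨
      (xₖ ⊕ yₖ) ++ ((apply τ xₖ ++ drop k x) ⊕ (apply τ yₖ ++ drop k y))
    ≡⟨ zipWith-++ _xor_ xₖ (apply τ xₖ ++ drop k x) yₖ (apply τ yₖ ++ drop k y) ⟨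
      coefficients τ x ⊕ coefficients τ y
    ∎
    where
    open ≡-Reasoning
    xₖ yₖ : Vector k
    xₖ = take k x
    yₖ = take k y

  coefficients-injective : ∀ τ → Injective _≡_ _≡_ (coefficients τ)
  coefficients-injective τ {x} {y} eq = begin
    x                        ≡⟨ take++drop≡id k x ⟨
    take k x ++ drop k x     ≡⟨ cong₂ _++_ take-eq drop-eq ⟩
    take k y ++ drop k y     ≡⟨ take++drop≡id k y ⟩
    y                        ∎
    where
    open ≡-Reasoning
    take-eq : take k x ≡ take k y
    take-eq = ++-injectiveˡ (take k x) (take k y) eq
    drop-eq : drop k x ≡ drop k y
    drop-eq = ++-injectiveʳ (apply τ (take k x)) (apply τ (take k y)) (++-injectiveʳ (take k x) (take k y) eq)

  graph : Vector j → Vector (k + u) → Vector n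
  graph τ v = comb P (coefficients τ v)

  graph-linear : ∀ τ → Linear (graph τ)
  graph-linear τ x y = trans (cong (comb P) (coefficients-linear τ x y)) (comb-⊕ P _ _)

  subspace : Vector j → Subspace n
  subspace τ = image (graph τ) (graph-linear τ)

  subspace-dim : ∀ τ → Dim (subspace τ) (k + u)
  subspace-dim τ = image-dim (graph-linear τ) (coefficients-injective τ ∘ comb-injective P CEB-independent)

  graph-over-0 : ∀ τ v → take k v ≡ 0v → graph τ v ≡ comb B (drop k v)
  graph-over-0 τ v vₖ≡0 = begin
      comb P (take k v ++ apply τ (take k v) ++ drop k v)
    ≡⟨ cong (λ β → comb P (β ++ apply τ β ++ drop k v)) vₖ≡0 ⟩
      comb P (0v {k} ++ apply τ 0v ++ drop k v)
    ≡⟨ cong (λ a → comb P (0v {k} ++ a ++ drop k v)) (Linear⇒0↦0 (linear τ)) ⟩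
      comb P (0v {k} ++ 0v {l} ++ drop k v)
    ≡⟨ comb-0v++ C (E ++ B) (0v ++ drop k v) ⟩
      comb (E ++ B) (0v {l} ++ drop k v)
    ≡⟨ comb-0v++ E B (drop k v) ⟩
      comb B (drop k v)
    ∎
    where open ≡-Reasoning

  graph-over-0-∈U : ∀ τ v → take k v ≡ 0v → U ∋ graph τ v
  graph-over-0-∈U τ v vₖ≡0 = subst (U ∋_) (sym (graph-over-0 τ v vₖ≡0)) (Dim.in-U DU (drop k v))

  U⊆subspace : ∀ τ → U ⊆ subspace τ
  U⊆subspace τ x x∈U with Dim.spans DU x x∈U
  ... | α , refl = 0v ++ α , (begin
    graph τ (0v ++ α)                   ≡⟨ graph-over-0 τ (0v ++ α) (take-++ (0v {k}) α) ⟩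
    comb B (drop k (0v {k} ++ α))       ≡⟨ cong (comb B) (drop-++ (0v {k}) α) ⟩
    comb B α                            ∎)
    where open ≡-Reasoning

  subspace∩W : ∀ τ → ∩≡ (subspace τ) W U
  subspace∩W τ x = ∩⊆U , λ x∈U → U⊆subspace τ x x∈U , U⊆W x x∈U
    where
    ∩⊆U : subspace τ ∋ x × W ∋ x → U ∋ x
    ∩⊆U ((v , refl) , x∈W) with W⊆EB x x∈W
    ... | g , eq = graph-over-0-∈U τ v (++-injectiveˡ (take k v) 0v
      (comb-injective P CEB-independent (trans (sym eq) (sym (comb-0v++ C (E ++ B) g)))))

  apply-agrees : ∀ τ τ′ v v′ → coefficients τ v ≡ coefficients τ′ v′ →
                 apply τ (take k v) ≡ apply τ′ (take k v)
  apply-agrees τ τ′ v v′ eq = begin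
    apply τ (take k v)     ≡⟨ ++-injectiveˡ _ _ (++-injectiveʳ (take k v) (take k v′) eq) ⟩
    apply τ′ (take k v′)   ≡⟨ cong (apply τ′) (++-injectiveˡ (take k v) (take k v′) eq) ⟨
    apply τ′ (take k v)    ∎
    where open ≡-Reasoning

  subspace∩subspace : ∀ {τ τ′} → τ ≢ τ′ → ∩≡ (subspace τ) (subspace τ′) U
  subspace∩subspace {τ} {τ′} τ≢τ′ x = ∩⊆U , λ x∈U → U⊆subspace τ x x∈U , U⊆subspace τ′ x x∈U
    where
    ∩⊆U : subspace τ ∋ x × subspace τ′ ∋ x → U ∋ x
    ∩⊆U ((v , refl) , (v′ , eq)) with agree-only-at-0 τ τ′ (take k v)
      (apply-agrees τ τ′ v v′ (comb-injective P CEB-independent (sym eq)))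
    ... | inj₁ vₖ≡0 = graph-over-0-∈U τ v vₖ≡0
    ... | inj₂ τ≡τ′ = ⊥-elim (τ≢τ′ τ≡τ′)

  family : ∀ {b} → b ≤ 2 ^ j → SubspaceFamily n U W (k + u) b
  family b≤2ʲ = 2 ^ j , subspace ∘ decode j , b≤2ʲ
    , (λ i → subspace-dim (decode j i) , subspace∩W (decode j i))
    , λ i i′ i≢i′ → subspace∩subspace (i≢i′ ∘ decode-injective j)

whole : ∀ n → Subspace n
whole n = image id (λ _ _ → refl)

whole-dim : ∀ n → Dim (whole n) n
whole-dim n = image-dim (λ _ _ → refl) id

exponent-bound : ∀ k l u → (k + (l + u)) ∸ 2 * (k + u) ≤ l ∸ k
exponent-bound k l u = begin
  (k + (l + u)) ∸ 2 * (k + u)    ≤⟨ ∸-monoʳ-≤ (k + (l + u)) k+[u+k]≤2[k+u] ⟩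
  (k + (l + u)) ∸ (k + (u + k))  ≡⟨ [m+n]∸[m+o]≡n∸o k (l + u) (u + k) ⟩
  (l + u) ∸ (u + k)              ≡⟨ cong (_∸ (u + k)) (+-comm l u) ⟩
  (u + l) ∸ (u + k)              ≡⟨ [m+n]∸[m+o]≡n∸o u l k ⟩
  l ∸ k                          ∎
  where
  open ≤-Reasoning
  k+[u+k]≤2[k+u] : k + (u + k) ≤ 2 * (k + u)
  k+[u+k]≤2[k+u] = begin
    k + (u + k)        ≡⟨ +-assoc k u k ⟨
    (k + u) + k        ≤⟨ +-monoʳ-≤ (k + u) (≤-trans (m≤m+n k u) (m≤m+n (k + u) 0)) ⟩
    2 * (k + u)        ∎

lemma3p1 : (n : ℕ) (U W : Subspace n) (u w : ℕ) → Dim U u → Dim W w → U ⊆ W →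
    Σ ℕ λ m → Σ (Fin m → Subspace n) λ Us →
      (m ≥ 2 ^ (n ∸ 2 * ((n ∸ w) + u))
      × (∀ i → Dim (Us i) ((n ∸ w) + u) × ∩≡ (Us i) W U)
      × (∀ i j → i ≢ j → ∩≡ (Us i) (Us j) U))
lemma3p1 n U W u w DU DW U⊆W =
  subst (λ d → SubspaceFamily n U W (d + u) (2 ^ (n ∸ 2 * (d + u)))) (sym n∸w≡k)
    (GraphConstruction.family {W = W} C E DU CEB-independent W⊆EB U⊆W (polynomialSpreadSet k l)
      (^-monoʳ-≤ 2 exponent≤))
  where
  W-basis : BasisExtension W (Dim.basis DU)
  W-basis = extend-to-basis DW (Dim.basis DU) (Dim.indep DU) (λ x → U⊆W x ∘ basis⊆ DU x)
  open BasisExtension W-basis using ()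
    renaming (size to l; vectors to E; independent to EB-independent; ⊆span to W⊆EB)

  V-basis : BasisExtension (whole n) (E ++ Dim.basis DU)
  V-basis = extend-to-basis (whole-dim n) (E ++ Dim.basis DU) EB-independent (λ x _ → x , refl)
  open BasisExtension V-basis using () renaming (size to k; vectors to C; independent to CEB-independent)

  k+[l+u]≡n : k + (l + u) ≡ n
  k+[l+u]≡n = BasisExtension.size+length≡dim V-basis (whole-dim n)

  n∸w≡k : n ∸ w ≡ k
  n∸w≡k = begin
    n ∸ w                  ≡⟨ cong₂ _∸_ k+[l+u]≡n (BasisExtension.size+length≡dim W-basis DW) ⟨
    k + (l + u) ∸ (l + u)  ≡⟨ m+n∸n≡m k (l + u) ⟩
    k                      ∎
    where open ≡-Reasoning

  exponent≤ : n ∸ 2 * (k + u) ≤ l ∸ k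
  exponent≤ = subst (λ m → m ∸ 2 * (k + u) ≤ l ∸ k) k+[l+u]≡n (exponent-bound k l u)
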